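{- For integers $n$ and $r\ge0$, let $D^{(r)}_n$ be the number of $n$-tilings containing exactly $r$ squares, where an $n$-tiling is a tiling of a board (of any length) using exactly $n$ tiles, each a square or a $(1,1)$-fence; set $D^{(r)}_n=0$ for $n<0$ and $D^{(0)}_0=1$. Then for all integers $n\ge r>0$, \[ D^{(r)}_n=D^{(r)}_{n-2}+\binom{n-1}{r-1}. \]
   Context: A board of length $L$ is a $1\times L$ row of unit cells. A square is a $1\times1$ tile. A $(1,1)$-fence is a tile consisting of two $1\times1$ posts separated by a one-cell gap; placed on a board its posts occupy cells $i$ and $i+2$, and the gap cell must be covered by another tile. A tiling covers every cell exactly once. The empty tiling is the unique $0$-tiling. -}

module Defs where

open import Data.Bool using (Bool; true; false; _∧_; _∨_; not; if_then_else_)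
open import Data.Nat using (ℕ; zero; suc; _+_; _*_; _≡ᵇ_; _<ᵇ_)
open import Data.List using (List; []; _∷_; map; concatMap; upTo; filterᵇ; length)
open import Data.Bool.ListAction using (all)
open import Data.Nat.ListAction using (sum)
open import Data.Product using (_×_; _,_; proj₁; proj₂)
open import Data.Integer using (ℤ; +_; -[1+_])

-- A tiling of a board of length L by squares and (1,1)-fences is encoded by
-- the set of tiles it uses, each tile identified by its kind and the cell of
-- its leftmost post.  The set is given by two Boolean lists of length L:
--   sq ! i = true  iff a square sits on cell i,
--   fe ! i = true  iff a fence has its posts on cells i and i+2.
-- Every tile must lie on the board and every cell is covered exactly once.

_!_ : List Bool → ℕ → Bool
[] ! _ = false
(b ∷ bs) ! zero = b
(b ∷ bs) ! suc k = bs ! k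

b2n : Bool → ℕ
b2n true = 1
b2n false = 0

boolLists : ℕ → List (List Bool)
boolLists zero = [] ∷ []
boolLists (suc L) = concatMap (λ bs → (false ∷ bs) ∷ (true ∷ bs) ∷ []) (boolLists L)

coverCount : List Bool → List Bool → ℕ → ℕ
coverCount sq fe c = b2n (sq ! c) + b2n (fe ! c) + leftPost c
  where
  leftPost : ℕ → ℕ
  leftPost (suc (suc k)) = b2n (fe ! k)
  leftPost _ = 0

fencesFit : ℕ → List Bool → Bool
fencesFit L fe = all (λ i → not (fe ! i) ∨ (suc (suc i) <ᵇ L)) (upTo L)

isTiling : ℕ → List Bool → List Bool → Bool
isTiling L sq fe = fencesFit L fe ∧ all (λ c → coverCount sq fe c ≡ᵇ 1) (upTo L)

countTrue : List Bool → ℕ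
countTrue bs = sum (map b2n bs)

tilingsOfLength : ℕ → ℕ → ℕ → ℕ
tilingsOfLength r n L =
  length (filterᵇ (λ p → isTiling L (proj₁ p) (proj₂ p)
                        ∧ (countTrue (proj₁ p) + countTrue (proj₂ p) ≡ᵇ n)
                        ∧ (countTrue (proj₁ p) ≡ᵇ r))
           (concatMap (λ sq → map (λ fe → (sq , fe)) (boolLists L)) (boolLists L)))

-- D^{(r)}_n for n ≥ 0: tilings of a board of any length with n tiles, r squares.
-- Each tile covers at most 2 cells, so only lengths L ≤ 2n can occur.
Dnat : ℕ → ℕ → ℕ
Dnat r n = sum (map (tilingsOfLength r n) (upTo (suc (2 * n))))

D : ℕ → ℤ → ℕ
D r (+ n) = Dnat r n
D r -[1+ _ ] = 0

{-# OPTIONS --safe #-}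
-- Read from left to right, a tiling splits uniquely into blocks: a square, a fence with a square
-- in its gap, or two interleaved fences (posts on i, i+2 and on i+1, i+3).  Checking the Boolean
-- encoding cell by cell, remembering which of the next two cells still owe a post to a fence placed
-- earlier, turns the count into a recursion on the length of the board, and the three blocks give
--   D^{(s+1)}_{m+2} = D^{(s)}_{m+1} + D^{(s)}_m + D^{(s+1)}_m.
-- By induction on n and Pascal's rule, D^{(s)}_{n+1} + D^{(s)}_n = C(n+1, s); substituting this
-- into the recurrence gives the theorem.
module Submission where

open import Defs
open import Data.Nat using (ℕ; _<_; _≤_; _+_; _∸_)
open import Data.Nat.Combinatorics using (_C_)
open import Data.Integer using (+_; _-_)
open import Relation.Binary.PropositionalEquality using (_≡_)

open import Data.Nat using (zero; suc; _*_; _≡ᵇ_; _<ᵇ_; z<s; s≤s; compare; less; equal; greater)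
open import Data.Nat.Properties
  using (_≟_; +-suc; +-comm; +-assoc; +-identityʳ; +-cancelˡ-≡; m≤m+n; m<m+n; n<1+n; m<n⇒m<1+n; <⇒≱; ≤-reflexive; m+n≤o⇒m≤o; suc-injective; +-commutativeSemigroup)
open import Data.Nat.Combinatorics using (nCk+nC[k+1]≡[n+1]C[k+1])
open import Data.Nat.Tactic.RingSolver using (solve-∀)
open import Data.Nat.ListAction using (sum)
open import Data.Nat.ListAction.Properties using (sum-++)
open import Algebra.Properties.CommutativeSemigroup +-commutativeSemigroup using (interchange)
open import Data.Bool using (Bool; true; false; _∧_; _∨_; not)
open import Data.Bool.Properties using (∧-zeroʳ)
open import Data.Bool.ListAction using (all; and)
open import Data.List using (List; []; _∷_; _++_; map; concatMap; upTo; filterᵇ; length)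
open import Data.List.Properties using (map-++; map-∘; map-cong; map-applyUpTo; map-upTo)
open import Data.Product using (_×_; _,_)
open import Data.Empty using (⊥; ⊥-elim)
open import Function using (_∘_)
open import Relation.Nullary using (yes; no)
open import Relation.Nullary.Decidable using (dec-true; dec-false)
open import Relation.Binary.PropositionalEquality using (_≢_; refl; sym; trans; cong; cong₂; subst; module ≡-Reasoning)

open ≡-Reasoning

length-filterᵇ : ∀ {A : Set} (p : A → Bool) (xs : List A) →
  length (filterᵇ p xs) ≡ sum (map (b2n ∘ p) xs)
length-filterᵇ p [] = refl
length-filterᵇ p (x ∷ xs) with p x
... | true  = cong suc (length-filterᵇ p xs)
... | false = length-filterᵇ p xs

sum-map-concatMap : ∀ {A B : Set} (h : B → ℕ) (k : A → List B) (xs : List A) →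
  sum (map h (concatMap k xs)) ≡ sum (map (λ x → sum (map h (k x))) xs)
sum-map-concatMap h k [] = refl
sum-map-concatMap h k (x ∷ xs) = begin
  sum (map h (k x ++ concatMap k xs))
    ≡⟨ cong sum (map-++ h (k x) (concatMap k xs)) ⟩
  sum (map h (k x) ++ map h (concatMap k xs))
    ≡⟨ sum-++ (map h (k x)) (map h (concatMap k xs)) ⟩
  sum (map h (k x)) + sum (map h (concatMap k xs))
    ≡⟨ cong (_+_ (sum (map h (k x)))) (sum-map-concatMap h k xs) ⟩
  sum (map (λ x → sum (map h (k x))) (x ∷ xs)) ∎

sum-map-zero : ∀ {A : Set} (h : A → ℕ) (xs : List A) → (∀ x → h x ≡ 0) → sum (map h xs) ≡ 0
sum-map-zero h [] _ = refl
sum-map-zero h (x ∷ xs) h≡0 = cong₂ _+_ (h≡0 x) (sum-map-zero h xs h≡0)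

sum-map-upTo-suc : ∀ (h : ℕ → ℕ) K → sum (map h (upTo (suc K))) ≡ h 0 + sum (map (h ∘ suc) (upTo K))
sum-map-upTo-suc h K =
  cong (λ xs → h 0 + sum xs) (trans (map-applyUpTo suc h K) (sym (map-upTo (h ∘ suc) K)))

sum-map-upTo-single : ∀ (h : ℕ → ℕ) {K} i → i < K → (∀ j → j ≢ i → h j ≡ 0) →
  sum (map h (upTo K)) ≡ h i
sum-map-upTo-single h {suc K} zero _ h≡0 = begin
  sum (map h (upTo (suc K)))            ≡⟨ sum-map-upTo-suc h K ⟩
  h 0 + sum (map (h ∘ suc) (upTo K))    ≡⟨ cong (_+_ (h 0)) (sum-map-zero (h ∘ suc) (upTo K) (λ j → h≡0 (suc j) λ ())) ⟩
  h 0 + 0                               ≡⟨ +-identityʳ (h 0) ⟩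
  h 0                                   ∎
sum-map-upTo-single h {suc K} (suc i) (s≤s i<K) h≡0 = begin
  sum (map h (upTo (suc K)))            ≡⟨ sum-map-upTo-suc h K ⟩
  h 0 + sum (map (h ∘ suc) (upTo K))    ≡⟨ cong₂ _+_ (h≡0 0 λ ()) (sum-map-upTo-single (h ∘ suc) i i<K h∘suc≡0) ⟩
  h (suc i)                             ∎
  where
  h∘suc≡0 : ∀ j → j ≢ i → h (suc j) ≡ 0
  h∘suc≡0 j j≢i = h≡0 (suc j) (j≢i ∘ suc-injective)

sumBoolLists : ℕ → (List Bool → ℕ) → ℕ
sumBoolLists zero    h = h []
sumBoolLists (suc L) h = sumBoolLists L (h ∘ (false ∷_)) + sumBoolLists L (h ∘ (true ∷_))

sumBoolLists-+ : ∀ L (g h : List Bool → ℕ) →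
  sumBoolLists L (λ x → g x + h x) ≡ sumBoolLists L g + sumBoolLists L h
sumBoolLists-+ zero    g h = refl
sumBoolLists-+ (suc L) g h = begin
  sumBoolLists L (λ x → g (false ∷ x) + h (false ∷ x)) + sumBoolLists L (λ x → g (true ∷ x) + h (true ∷ x))
    ≡⟨ cong₂ _+_ (sumBoolLists-+ L _ _) (sumBoolLists-+ L _ _) ⟩
  (sumBoolLists L (g ∘ (false ∷_)) + sumBoolLists L (h ∘ (false ∷_)))
    + (sumBoolLists L (g ∘ (true ∷_)) + sumBoolLists L (h ∘ (true ∷_)))
    ≡⟨ interchange (sumBoolLists L (g ∘ (false ∷_))) (sumBoolLists L (h ∘ (false ∷_)))
                   (sumBoolLists L (g ∘ (true ∷_))) (sumBoolLists L (h ∘ (true ∷_))) ⟩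
  sumBoolLists (suc L) g + sumBoolLists (suc L) h ∎

sumBoolLists-cong : ∀ L {g h : List Bool → ℕ} → (∀ x → g x ≡ h x) → sumBoolLists L g ≡ sumBoolLists L h
sumBoolLists-cong zero    g≡h = g≡h []
sumBoolLists-cong (suc L) g≡h =
  cong₂ _+_ (sumBoolLists-cong L (g≡h ∘ (false ∷_))) (sumBoolLists-cong L (g≡h ∘ (true ∷_)))

sum-boolLists : ∀ L (h : List Bool → ℕ) → sum (map h (boolLists L)) ≡ sumBoolLists L h
sum-boolLists zero    h = +-identityʳ (h [])
sum-boolLists (suc L) h = begin
  sum (map h (boolLists (suc L)))
    ≡⟨ sum-map-concatMap h _ (boolLists L) ⟩
  sum (map (λ x → h (false ∷ x) + (h (true ∷ x) + 0)) (boolLists L))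
    ≡⟨ sum-boolLists L _ ⟩
  sumBoolLists L (λ x → h (false ∷ x) + (h (true ∷ x) + 0))
    ≡⟨ sumBoolLists-cong L (λ x → cong (_+_ (h (false ∷ x))) (+-identityʳ (h (true ∷ x)))) ⟩
  sumBoolLists L (λ x → h (false ∷ x) + h (true ∷ x))
    ≡⟨ sumBoolLists-+ L _ _ ⟩
  sumBoolLists (suc L) h ∎

-- Peels off both heads at once, like a left-to-right scan of the board.
sumBoolListPairs : ℕ → (List Bool → List Bool → ℕ) → ℕ
sumBoolListPairs zero    g = g [] []
sumBoolListPairs (suc L) g =
    (sumBoolListPairs L (λ x y → g (false ∷ x) (false ∷ y)) + sumBoolListPairs L (λ x y → g (false ∷ x) (true ∷ y)))
  + (sumBoolListPairs L (λ x y → g (true ∷ x) (false ∷ y))  + sumBoolListPairs L (λ x y → g (true ∷ x) (true ∷ y)))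

sumBoolLists-nested : ∀ L (g : List Bool → List Bool → ℕ) →
  sumBoolLists L (λ x → sumBoolLists L (g x)) ≡ sumBoolListPairs L g
sumBoolLists-nested zero    g = refl
sumBoolLists-nested (suc L) g = cong₂ _+_ (split (false ∷_)) (split (true ∷_))
  where
  split : (f : List Bool → List Bool) →
    sumBoolLists L (λ x → sumBoolLists (suc L) (g (f x)))
      ≡ sumBoolListPairs L (λ x y → g (f x) (false ∷ y)) + sumBoolListPairs L (λ x y → g (f x) (true ∷ y))
  split f = trans (sumBoolLists-+ L _ _) (cong₂ _+_ (sumBoolLists-nested L _) (sumBoolLists-nested L _))

sumBoolListPairs-cong : ∀ L {g h : List Bool → List Bool → ℕ} →
  (∀ x y → length x ≡ L → length y ≡ L → g x y ≡ h x y) → sumBoolListPairs L g ≡ sumBoolListPairs L h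
sumBoolListPairs-cong zero    g≡h = g≡h [] [] refl refl
sumBoolListPairs-cong (suc L) {g} {h} g≡h =
  cong₂ _+_ (cong₂ _+_ (step false false) (step false true)) (cong₂ _+_ (step true false) (step true true))
  where
  step : ∀ s f → sumBoolListPairs L (λ x y → g (s ∷ x) (f ∷ y)) ≡ sumBoolListPairs L (λ x y → h (s ∷ x) (f ∷ y))
  step s f = sumBoolListPairs-cong L (λ x y ∣x∣ ∣y∣ → g≡h (s ∷ x) (f ∷ y) (cong suc ∣x∣) (cong suc ∣y∣))

sumBoolListPairs-zero : ∀ L → sumBoolListPairs L (λ _ _ → 0) ≡ 0
sumBoolListPairs-zero zero    = refl
sumBoolListPairs-zero (suc L) rewrite sumBoolListPairs-zero L = refl

sum-boolListPairs : ∀ L (g : List Bool × List Bool → ℕ) →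
  sum (map g (concatMap (λ sq → map (λ fe → (sq , fe)) (boolLists L)) (boolLists L)))
    ≡ sumBoolListPairs L (λ sq fe → g (sq , fe))
sum-boolListPairs L g = begin
  sum (map g (concatMap (λ sq → map (λ fe → (sq , fe)) (boolLists L)) (boolLists L)))
    ≡⟨ sum-map-concatMap g _ (boolLists L) ⟩
  sum (map (λ sq → sum (map g (map (λ fe → (sq , fe)) (boolLists L)))) (boolLists L))
    ≡⟨ cong sum (map-cong inner (boolLists L)) ⟩
  sum (map (λ sq → sumBoolLists L (λ fe → g (sq , fe))) (boolLists L))
    ≡⟨ sum-boolLists L _ ⟩
  sumBoolLists L (λ sq → sumBoolLists L (λ fe → g (sq , fe)))
    ≡⟨ sumBoolLists-nested L _ ⟩
  sumBoolListPairs L (λ sq fe → g (sq , fe)) ∎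
  where
  inner : ∀ sq → sum (map g (map (λ fe → (sq , fe)) (boolLists L))) ≡ sumBoolLists L (λ fe → g (sq , fe))
  inner sq = trans (cong sum (sym (map-∘ (boolLists L)))) (sum-boolLists L _)

-- Checking a tiling cell by cell

-- p₁ and p₂ say whether the first and the second remaining cell hold the right post of a fence placed earlier.
scanTiling : Bool → Bool → List Bool → List Bool → Bool
scanTiling p₁ p₂ []       []       = not p₁ ∧ not p₂
scanTiling p₁ p₂ (s ∷ sq) (f ∷ fe) = (b2n s + b2n f + b2n p₁ ≡ᵇ 1) ∧ scanTiling p₂ f sq fe
scanTiling _  _  _        _        = false

coverCountPending : Bool → Bool → List Bool → List Bool → ℕ → ℕ
coverCountPending p₁ p₂ sq fe c = b2n (sq ! c) + b2n (fe ! c) + b2n ((p₁ ∷ p₂ ∷ fe) ! c)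

pendingFit : Bool → Bool → ℕ → Bool
pendingFit p₁ p₂ L = (not p₁ ∨ (0 <ᵇ L)) ∧ (not p₂ ∨ (1 <ᵇ L))

isTilingPending : Bool → Bool → ℕ → List Bool → List Bool → Bool
isTilingPending p₁ p₂ L sq fe =
  pendingFit p₁ p₂ L ∧ (fencesFit L fe ∧ all (λ c → coverCountPending p₁ p₂ sq fe c ≡ᵇ 1) (upTo L))

pendingFit-suc : ∀ p₁ p₂ L → pendingFit p₁ p₂ (suc L) ≡ not p₂ ∨ (0 <ᵇ L)
pendingFit-suc false p₂ L = refl
pendingFit-suc true  p₂ L = refl

all-upTo-suc : ∀ (p : ℕ → Bool) L → all p (upTo (suc L)) ≡ p 0 ∧ all (p ∘ suc) (upTo L)
all-upTo-suc p L =
  cong (λ bs → p 0 ∧ and bs) (trans (map-applyUpTo suc p L) (sym (map-upTo (p ∘ suc) L)))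

∧-rearrange : ∀ a b c d e → a ∧ ((b ∧ c) ∧ (d ∧ e)) ≡ d ∧ ((a ∧ b) ∧ (c ∧ e))
∧-rearrange true  true  c true  e = refl
∧-rearrange true  false c true  e = refl
∧-rearrange false b     c true  e = refl
∧-rearrange true  b     c false e = ∧-zeroʳ (b ∧ c)
∧-rearrange false b     c false e = refl

isTilingPending≡scanTiling : ∀ L p₁ p₂ sq fe → length sq ≡ L → length fe ≡ L →
  isTilingPending p₁ p₂ L sq fe ≡ scanTiling p₁ p₂ sq fe
isTilingPending≡scanTiling zero false false [] [] _ _ = refl
isTilingPending≡scanTiling zero false true  [] [] _ _ = refl
isTilingPending≡scanTiling zero true  _     [] [] _ _ = refl
isTilingPending≡scanTiling (suc L) p₁ p₂ (s ∷ sq) (f ∷ fe) ∣sq∣ ∣fe∣ = begin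
  isTilingPending p₁ p₂ (suc L) (s ∷ sq) (f ∷ fe)
    ≡⟨ cong₂ (λ u v → pendingFit p₁ p₂ (suc L) ∧ (u ∧ v)) (all-upTo-suc fits L) (all-upTo-suc covered L) ⟩
  pendingFit p₁ p₂ (suc L) ∧ ((fitsHere ∧ fencesFit L fe) ∧ (coveredHere ∧ coveredLater))
    ≡⟨ cong (λ b → b ∧ ((fitsHere ∧ fencesFit L fe) ∧ (coveredHere ∧ coveredLater))) (pendingFit-suc p₁ p₂ L) ⟩
  (not p₂ ∨ (0 <ᵇ L)) ∧ ((fitsHere ∧ fencesFit L fe) ∧ (coveredHere ∧ coveredLater))
    ≡⟨ ∧-rearrange (not p₂ ∨ (0 <ᵇ L)) fitsHere (fencesFit L fe) coveredHere coveredLater ⟩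
  coveredHere ∧ isTilingPending p₂ f L sq fe
    ≡⟨ cong (coveredHere ∧_) (isTilingPending≡scanTiling L p₂ f sq fe (suc-injective ∣sq∣) (suc-injective ∣fe∣)) ⟩
  scanTiling p₁ p₂ (s ∷ sq) (f ∷ fe) ∎
  where
  fits covered : ℕ → Bool
  fits i       = not ((f ∷ fe) ! i) ∨ (suc (suc i) <ᵇ suc L)
  covered c    = coverCountPending p₁ p₂ (s ∷ sq) (f ∷ fe) c ≡ᵇ 1
  fitsHere coveredHere coveredLater : Bool
  fitsHere     = not f ∨ (1 <ᵇ L)
  coveredHere  = b2n s + b2n f + b2n p₁ ≡ᵇ 1
  coveredLater = all (λ c → coverCountPending p₂ f sq fe c ≡ᵇ 1) (upTo L)
isTilingPending≡scanTiling zero    _ _ []      (_ ∷ _) _  ()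
isTilingPending≡scanTiling zero    _ _ (_ ∷ _) _       () _
isTilingPending≡scanTiling (suc L) _ _ []      _       () _
isTilingPending≡scanTiling (suc L) _ _ (_ ∷ _) []      _  ()

isTiling≡scanTiling : ∀ L sq fe → length sq ≡ L → length fe ≡ L → isTiling L sq fe ≡ scanTiling false false sq fe
isTiling≡scanTiling L sq fe ∣sq∣ ∣fe∣ = begin
  isTiling L sq fe
    ≡⟨ cong (λ bs → fencesFit L fe ∧ and bs) (map-cong (λ c → cong (_≡ᵇ 1) (coverCount≡ c)) (upTo L)) ⟩
  isTilingPending false false L sq fe
    ≡⟨ isTilingPending≡scanTiling L false false sq fe ∣sq∣ ∣fe∣ ⟩
  scanTiling false false sq fe ∎
  where
  coverCount≡ : ∀ c → coverCount sq fe c ≡ coverCountPending false false sq fe c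
  coverCount≡ zero          = refl
  coverCount≡ (suc zero)    = refl
  coverCount≡ (suc (suc c)) = refl

-- Counting tilings by their numbers of squares and fences

countTilings : Bool → Bool → ℕ → (ℕ → ℕ → Bool) → ℕ
countTilings p₁    p₂ zero    Q = b2n ((not p₁ ∧ not p₂) ∧ Q 0 0)
countTilings false p₂ (suc L) Q = countTilings p₂ false L (λ a b → Q (suc a) b) + countTilings p₂ true L (λ a b → Q a (suc b))
countTilings true  p₂ (suc L) Q = countTilings p₂ false L Q

sum-scanTiling : ∀ L p₁ p₂ (Q : ℕ → ℕ → Bool) →
  sumBoolListPairs L (λ sq fe → b2n (scanTiling p₁ p₂ sq fe ∧ Q (countTrue sq) (countTrue fe)))
    ≡ countTilings p₁ p₂ L Q
sum-scanTiling zero    p₁    p₂ Q = refl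
sum-scanTiling (suc L) false p₂ Q = begin
  (sumBoolListPairs L (λ _ _ → 0) + fence) + (square + sumBoolListPairs L (λ _ _ → 0))
    ≡⟨ cong₂ (λ u v → (u + fence) + (square + v)) (sumBoolListPairs-zero L) (sumBoolListPairs-zero L) ⟩
  fence + (square + 0)
    ≡⟨ cong (_+_ fence) (+-identityʳ square) ⟩
  fence + square
    ≡⟨ +-comm fence square ⟩
  square + fence
    ≡⟨ cong₂ _+_ (sum-scanTiling L p₂ false _) (sum-scanTiling L p₂ true _) ⟩
  countTilings false p₂ (suc L) Q ∎
  where
  square fence : ℕ
  square = sumBoolListPairs L (λ sq fe → b2n (scanTiling p₂ false sq fe ∧ Q (suc (countTrue sq)) (countTrue fe)))
  fence  = sumBoolListPairs L (λ sq fe → b2n (scanTiling p₂ true sq fe ∧ Q (countTrue sq) (suc (countTrue fe))))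
sum-scanTiling (suc L) true  p₂ Q = begin
  (empty + sumBoolListPairs L (λ _ _ → 0)) + (sumBoolListPairs L (λ _ _ → 0) + sumBoolListPairs L (λ _ _ → 0))
    ≡⟨ cong₂ (λ u v → (empty + u) + (v + v)) (sumBoolListPairs-zero L) (sumBoolListPairs-zero L) ⟩
  (empty + 0) + 0
    ≡⟨ trans (+-identityʳ (empty + 0)) (+-identityʳ empty) ⟩
  empty
    ≡⟨ sum-scanTiling L p₂ false Q ⟩
  countTilings true p₂ (suc L) Q ∎
  where
  empty : ℕ
  empty = sumBoolListPairs L (λ sq fe → b2n (scanTiling p₂ false sq fe ∧ Q (countTrue sq) (countTrue fe)))

tilesSquares : ℕ → ℕ → ℕ → ℕ → Bool
tilesSquares n r a b = (a + b ≡ᵇ n) ∧ (a ≡ᵇ r)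

tilingsOfLength≡countTilings : ∀ r n L → tilingsOfLength r n L ≡ countTilings false false L (tilesSquares n r)
tilingsOfLength≡countTilings r n L = begin
  tilingsOfLength r n L
    ≡⟨ length-filterᵇ accepted (concatMap (λ sq → map (λ fe → (sq , fe)) (boolLists L)) (boolLists L)) ⟩
  sum (map (b2n ∘ accepted) (concatMap (λ sq → map (λ fe → (sq , fe)) (boolLists L)) (boolLists L)))
    ≡⟨ sum-boolListPairs L (b2n ∘ accepted) ⟩
  sumBoolListPairs L (λ sq fe → b2n (isTiling L sq fe ∧ counts sq fe))
    ≡⟨ sumBoolListPairs-cong L (λ sq fe ∣sq∣ ∣fe∣ →
         cong (λ b → b2n (b ∧ counts sq fe)) (isTiling≡scanTiling L sq fe ∣sq∣ ∣fe∣)) ⟩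
  sumBoolListPairs L (λ sq fe → b2n (scanTiling false false sq fe ∧ counts sq fe))
    ≡⟨ sum-scanTiling L false false _ ⟩
  countTilings false false L (tilesSquares n r) ∎
  where
  counts : List Bool → List Bool → Bool
  counts sq fe = tilesSquares n r (countTrue sq) (countTrue fe)
  accepted : List Bool × List Bool → Bool
  accepted (sq , fe) = isTiling L sq fe ∧ counts sq fe

countTilings-cong : ∀ L p₁ p₂ {Q Q′ : ℕ → ℕ → Bool} →
  (∀ a b → Q a b ≡ Q′ a b) → countTilings p₁ p₂ L Q ≡ countTilings p₁ p₂ L Q′
countTilings-cong zero    p₁    p₂ Q≡Q′ = cong (λ v → b2n ((not p₁ ∧ not p₂) ∧ v)) (Q≡Q′ 0 0)
countTilings-cong (suc L) false p₂ Q≡Q′ =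
  cong₂ _+_ (countTilings-cong L p₂ false (Q≡Q′ ∘ suc)) (countTilings-cong L p₂ true (λ a b → Q≡Q′ a (suc b)))
countTilings-cong (suc L) true  p₂ Q≡Q′ = countTilings-cong L p₂ false Q≡Q′

footprint : Bool → Bool → ℕ → ℕ → ℕ
footprint p₁ p₂ a b = b2n p₁ + b2n p₂ + (a + (b + b))

+-double-suc : ∀ a b → a + (suc b + suc b) ≡ suc (suc (a + (b + b)))
+-double-suc = solve-∀

footprint-square : ∀ p a b → footprint false p (suc a) b ≡ suc (footprint p false a b)
footprint-square false a b = refl
footprint-square true  a b = refl

footprint-fence : ∀ p a b → footprint false p a (suc b) ≡ suc (footprint p true a b)
footprint-fence false a b = +-double-suc a b
footprint-fence true  a b = cong suc (+-double-suc a b)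

footprint-pending : ∀ p a b → footprint true p a b ≡ suc (footprint p false a b)
footprint-pending false a b = refl
footprint-pending true  a b = refl

-- Squares, fences and pending posts fill the board exactly.
countTilings-vanishes : ∀ L p₁ p₂ {Q : ℕ → ℕ → Bool} →
  (∀ a b → footprint p₁ p₂ a b ≡ L → Q a b ≡ false) → countTilings p₁ p₂ L Q ≡ 0
countTilings-vanishes zero    false false Q≡false = cong b2n (Q≡false 0 0 refl)
countTilings-vanishes zero    false true  _       = refl
countTilings-vanishes zero    true  _     _       = refl
countTilings-vanishes (suc L) false p₂    Q≡false = cong₂ _+_
  (countTilings-vanishes L p₂ false (λ a b fp → Q≡false (suc a) b (trans (footprint-square p₂ a b) (cong suc fp))))
  (countTilings-vanishes L p₂ true  (λ a b fp → Q≡false a (suc b) (trans (footprint-fence p₂ a b) (cong suc fp))))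
countTilings-vanishes (suc L) true  p₂    Q≡false =
  countTilings-vanishes L p₂ false (λ a b fp → Q≡false a b (trans (footprint-pending p₂ a b) (cong suc fp)))

countTilings-none : ∀ L p₁ p₂ {Q : ℕ → ℕ → Bool} → (∀ a b → Q a b ≡ false) → countTilings p₁ p₂ L Q ≡ 0
countTilings-none L p₁ p₂ Q≡false = countTilings-vanishes L p₁ p₂ (λ a b _ → Q≡false a b)

exactly : ℕ → ℕ → ℕ → ℕ → Bool
exactly a b x y = (x ≡ᵇ a) ∧ (y ≡ᵇ b)

tilings : ℕ → ℕ → ℕ
tilings a b = countTilings false false (a + (b + b)) (exactly a b)

-- `m ≡ᵇ n` is `does (m ≟ n)` by definition.
≡ᵇ-true : ∀ {m n} → m ≡ n → (m ≡ᵇ n) ≡ true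
≡ᵇ-true {m} {n} = dec-true (m ≟ n)

≡ᵇ-false : ∀ {m n} → m ≢ n → (m ≡ᵇ n) ≡ false
≡ᵇ-false {m} {n} = dec-false (m ≟ n)

exactly-false : ∀ {a b x y} → (x ≡ a → y ≡ b → ⊥) → exactly a b x y ≡ false
exactly-false {a} {b} {x} {y} ≢ab with x ≟ a | y ≟ b
... | yes refl | yes refl = ⊥-elim (≢ab refl refl)
... | no x≢a   | _        rewrite ≡ᵇ-false x≢a = refl
... | yes refl | no y≢b   rewrite ≡ᵇ-false y≢b = ∧-zeroʳ (x ≡ᵇ x)

tilesSquares-+ : ∀ a b x y → tilesSquares (a + b) a x y ≡ exactly a b x y
tilesSquares-+ a b x y with x ≟ a | y ≟ b
... | yes refl | yes refl rewrite ≡ᵇ-true (refl {x = x + y}) | ≡ᵇ-true (refl {x = x}) | ≡ᵇ-true (refl {x = y}) = refl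
... | no x≢a   | _        rewrite ≡ᵇ-false x≢a = ∧-zeroʳ (x + y ≡ᵇ a + b)
... | yes refl | no y≢b   rewrite ≡ᵇ-false (y≢b ∘ +-cancelˡ-≡ x y b) | ≡ᵇ-false y≢b = sym (∧-zeroʳ (x ≡ᵇ x))

tilesSquares-< : ∀ {n r} x y → n < r → tilesSquares n r x y ≡ false
tilesSquares-< {n} {r} x y n<r with x ≟ r
... | yes refl rewrite ≡ᵇ-false {x + y} {n} (λ x+y≡n → <⇒≱ n<r (m+n≤o⇒m≤o x (≤-reflexive x+y≡n))) = refl
... | no x≢r   rewrite ≡ᵇ-false x≢r = ∧-zeroʳ (x + y ≡ᵇ n)

+-double-suc² : ∀ a b → a + (suc (suc b) + suc (suc b)) ≡ suc (suc (suc (suc (a + (b + b)))))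
+-double-suc² a b = trans (+-double-suc a (suc b)) (cong (suc ∘ suc) (+-double-suc a b))

tilings-suc-suc : ∀ a b → tilings (suc a) (suc (suc b)) ≡ tilings a (suc (suc b)) + (tilings a (suc b) + tilings (suc a) b)
tilings-suc-suc a b = cong (_+_ (tilings a (suc (suc b)))) (begin
  countTilings false true (a + (suc (suc b) + suc (suc b))) (λ x y → exactly (suc a) (suc (suc b)) x (suc y))
    ≡⟨ cong (λ L → countTilings false true L (λ x y → exactly (suc a) (suc (suc b)) x (suc y))) (+-double-suc² a b) ⟩
  countTilings false false (suc (suc (a + (b + b)))) (exactly a (suc b)) + tilings (suc a) b
    ≡⟨ cong (λ L → countTilings false false L (exactly a (suc b)) + tilings (suc a) b) (sym (+-double-suc a b)) ⟩
  tilings a (suc b) + tilings (suc a) b ∎)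

tilings-suc-one : ∀ a → tilings (suc a) 1 ≡ tilings a 1 + tilings a 0
tilings-suc-one a = cong (_+_ (tilings a 1)) (begin
  countTilings false true (a + 2) (λ x y → exactly (suc a) 1 x (suc y))
    ≡⟨ cong (λ L → countTilings false true L (λ x y → exactly (suc a) 1 x (suc y))) (+-double-suc a 0) ⟩
  tilings a 0 + countTilings true false (a + 0) (λ x y → (x ≡ᵇ suc a) ∧ false)
    ≡⟨ cong (_+_ (tilings a 0)) (countTilings-none (a + 0) true false (λ x _ → ∧-zeroʳ (x ≡ᵇ suc a))) ⟩
  tilings a 0 + 0
    ≡⟨ +-identityʳ (tilings a 0) ⟩
  tilings a 0 ∎)

tilings-suc-zero : ∀ a → tilings (suc a) 0 ≡ tilings a 0
tilings-suc-zero a = begin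
  tilings (suc a) 0
    ≡⟨⟩
  tilings a 0 + countTilings false true (a + 0) (λ x y → (x ≡ᵇ suc a) ∧ false)
    ≡⟨ cong (_+_ (tilings a 0)) (countTilings-none (a + 0) false true (λ x _ → ∧-zeroʳ (x ≡ᵇ suc a))) ⟩
  tilings a 0 + 0
    ≡⟨ +-identityʳ (tilings a 0) ⟩
  tilings a 0 ∎

tilings-zero-suc-suc : ∀ b → tilings 0 (suc (suc b)) ≡ tilings 0 b
tilings-zero-suc-suc b = begin
  tilings 0 (suc (suc b))
    ≡⟨ cong (λ L → countTilings false false L (exactly 0 (suc (suc b)))) (+-double-suc² 0 b) ⟩
  countTilings false false (suc (suc (suc (b + b)))) (λ _ _ → false)
    + (countTilings false false (suc (b + b)) (λ _ _ → false) + tilings 0 b)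
    ≡⟨ cong₂ (λ u v → u + (v + tilings 0 b))
             (countTilings-none (suc (suc (suc (b + b)))) false false (λ _ _ → refl))
             (countTilings-none (suc (b + b)) false false (λ _ _ → refl)) ⟩
  tilings 0 b ∎

Dnat-tilings : ∀ a b → Dnat a (a + b) ≡ tilings a b
Dnat-tilings a b = begin
  Dnat a (a + b)
    ≡⟨ sum-map-upTo-single (tilingsOfLength a (a + b)) (a + (b + b)) (s≤s length≤) elsewhere ⟩
  tilingsOfLength a (a + b) (a + (b + b))
    ≡⟨ tilingsOfLength≡countTilings a (a + b) (a + (b + b)) ⟩
  countTilings false false (a + (b + b)) (tilesSquares (a + b) a)
    ≡⟨ countTilings-cong (a + (b + b)) false false (tilesSquares-+ a b) ⟩
  tilings a b ∎
  where
  double : ∀ a b → a + (b + b) + a ≡ 2 * (a + b)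
  double = solve-∀
  length≤ : a + (b + b) ≤ 2 * (a + b)
  length≤ = subst (a + (b + b) ≤_) (double a b) (m≤m+n (a + (b + b)) a)
  elsewhere : ∀ L → L ≢ a + (b + b) → tilingsOfLength a (a + b) L ≡ 0
  elsewhere L L≢ = begin
    tilingsOfLength a (a + b) L                        ≡⟨ tilingsOfLength≡countTilings a (a + b) L ⟩
    countTilings false false L (tilesSquares (a + b) a) ≡⟨ countTilings-cong L false false (tilesSquares-+ a b) ⟩
    countTilings false false L (exactly a b)           ≡⟨ countTilings-vanishes L false false
                                                            (λ x y fp → exactly-false {a} {b} {x} {y} λ { refl refl → L≢ (sym fp) }) ⟩
    0 ∎

Dnat-tilings′ : ∀ {a n} b → n ≡ a + b → Dnat a n ≡ tilings a b
Dnat-tilings′ {a} b refl = Dnat-tilings a b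

Dnat-below : ∀ {r n} → n < r → Dnat r n ≡ 0
Dnat-below {r} {n} n<r = sum-map-zero (tilingsOfLength r n) (upTo (suc (2 * n))) λ L →
  trans (tilingsOfLength≡countTilings r n L) (countTilings-none L false false (λ x y → tilesSquares-< x y n<r))

Dnat-rec-diagonal : ∀ m → Dnat (suc (suc m)) (suc (suc m)) ≡ (Dnat (suc m) (suc m) + Dnat (suc m) m) + Dnat (suc (suc m)) m
Dnat-rec-diagonal m = begin
  Dnat (suc (suc m)) (suc (suc m))
    ≡⟨ Dnat-tilings′ 0 (sym (+-identityʳ (suc (suc m)))) ⟩
  tilings (suc (suc m)) 0
    ≡⟨ tilings-suc-zero (suc m) ⟩
  tilings (suc m) 0
    ≡⟨ Dnat-tilings′ 0 (sym (+-identityʳ (suc m))) ⟨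
  Dnat (suc m) (suc m)
    ≡⟨ trans (+-identityʳ (Dnat (suc m) (suc m) + 0)) (+-identityʳ (Dnat (suc m) (suc m))) ⟨
  (Dnat (suc m) (suc m) + 0) + 0
    ≡⟨ cong₂ (λ u v → (Dnat (suc m) (suc m) + u) + v) (Dnat-below (n<1+n m)) (Dnat-below (m<n⇒m<1+n (n<1+n m))) ⟨
  (Dnat (suc m) (suc m) + Dnat (suc m) m) + Dnat (suc (suc m)) m ∎

Dnat-rec : ∀ s m → Dnat (suc s) (suc (suc m)) ≡ (Dnat s (suc m) + Dnat s m) + Dnat (suc s) m
Dnat-rec s m with compare s m
... | less s k = begin
  Dnat (suc s) (suc (suc (suc (s + k))))
    ≡⟨ Dnat-tilings′ (suc (suc k)) (cong suc s+2+k) ⟩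
  tilings (suc s) (suc (suc k))
    ≡⟨ tilings-suc-suc s k ⟩
  tilings s (suc (suc k)) + (tilings s (suc k) + tilings (suc s) k)
    ≡⟨ +-assoc (tilings s (suc (suc k))) (tilings s (suc k)) (tilings (suc s) k) ⟨
  (tilings s (suc (suc k)) + tilings s (suc k)) + tilings (suc s) k
    ≡⟨ cong₂ _+_ (cong₂ _+_ (Dnat-tilings′ (suc (suc k)) s+2+k) (Dnat-tilings′ (suc k) (sym (+-suc s k))))
                 (Dnat-tilings (suc s) k) ⟨
  (Dnat s (suc (suc (s + k))) + Dnat s (suc (s + k))) + Dnat (suc s) (suc (s + k)) ∎
  where
  s+2+k : suc (suc (s + k)) ≡ s + suc (suc k)
  s+2+k = sym (trans (+-suc s (suc k)) (cong suc (+-suc s k)))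
... | equal s = begin
  Dnat (suc s) (suc (suc s))
    ≡⟨ Dnat-tilings′ 1 (cong suc (+-comm 1 s)) ⟩
  tilings (suc s) 1
    ≡⟨ tilings-suc-one s ⟩
  tilings s 1 + tilings s 0
    ≡⟨ cong₂ _+_ (Dnat-tilings′ 1 (+-comm 1 s)) (Dnat-tilings′ 0 (sym (+-identityʳ s))) ⟨
  Dnat s (suc s) + Dnat s s
    ≡⟨ +-identityʳ (Dnat s (suc s) + Dnat s s) ⟨
  (Dnat s (suc s) + Dnat s s) + 0
    ≡⟨ cong (_+_ (Dnat s (suc s) + Dnat s s)) (Dnat-below (n<1+n s)) ⟨
  (Dnat s (suc s) + Dnat s s) + Dnat (suc s) s ∎
... | greater m zero =
  subst (λ t → Dnat (suc (suc t)) (suc (suc m)) ≡ (Dnat (suc t) (suc m) + Dnat (suc t) m) + Dnat (suc (suc t)) m)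
        (sym (+-identityʳ m)) (Dnat-rec-diagonal m)
... | greater m (suc k) =
  trans (Dnat-below (s≤s (s≤s m<m+1+k)))
        (sym (cong₂ _+_ (cong₂ _+_ (Dnat-below (s≤s m<m+1+k)) (Dnat-below (m<n⇒m<1+n m<m+1+k)))
                        (Dnat-below (m<n⇒m<1+n (m<n⇒m<1+n m<m+1+k)))))
  where
  m<m+1+k : m < m + suc k
  m<m+1+k = m<m+n m z<s

Dnat-zero-rec : ∀ m → Dnat 0 (suc (suc m)) ≡ Dnat 0 m
Dnat-zero-rec m = begin
  Dnat 0 (suc (suc m))     ≡⟨ Dnat-tilings 0 (suc (suc m)) ⟩
  tilings 0 (suc (suc m))  ≡⟨ tilings-zero-suc-suc m ⟩
  tilings 0 m              ≡⟨ Dnat-tilings 0 m ⟨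
  Dnat 0 m                 ∎

Dnat-pascal : ∀ n s → Dnat s (suc n) + Dnat s n ≡ suc n C s
Dnat-pascal zero    zero          = refl
Dnat-pascal zero    (suc zero)    = refl
Dnat-pascal zero    (suc (suc s)) = refl
Dnat-pascal (suc n) zero = begin
  Dnat 0 (suc (suc n)) + Dnat 0 (suc n) ≡⟨ cong (λ d → d + Dnat 0 (suc n)) (Dnat-zero-rec n) ⟩
  Dnat 0 n + Dnat 0 (suc n)             ≡⟨ +-comm (Dnat 0 n) (Dnat 0 (suc n)) ⟩
  Dnat 0 (suc n) + Dnat 0 n             ≡⟨ Dnat-pascal n zero ⟩
  1                                     ∎
Dnat-pascal (suc n) (suc s) = begin
  Dnat (suc s) (suc (suc n)) + Dnat (suc s) (suc n)
    ≡⟨ cong (λ d → d + Dnat (suc s) (suc n)) (Dnat-rec s n) ⟩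
  ((Dnat s (suc n) + Dnat s n) + Dnat (suc s) n) + Dnat (suc s) (suc n)
    ≡⟨ +-assoc (Dnat s (suc n) + Dnat s n) (Dnat (suc s) n) (Dnat (suc s) (suc n)) ⟩
  (Dnat s (suc n) + Dnat s n) + (Dnat (suc s) n + Dnat (suc s) (suc n))
    ≡⟨ cong₂ _+_ (Dnat-pascal n s) (trans (+-comm (Dnat (suc s) n) (Dnat (suc s) (suc n))) (Dnat-pascal n (suc s))) ⟩
  suc n C s + suc n C suc s
    ≡⟨ nCk+nC[k+1]≡[n+1]C[k+1] (suc n) s ⟩
  suc (suc n) C suc s ∎

lemma4p6 : (n r : ℕ) → 0 < r → r ≤ n →
    D r (+ n) ≡ D r (+ n - + 2) + ((n ∸ 1) C (r ∸ 1))
lemma4p6 _             zero          ()  _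
lemma4p6 zero          (suc _)       _   ()
lemma4p6 (suc zero)    (suc zero)    _   _               = refl
lemma4p6 (suc zero)    (suc (suc _)) _   (s≤s ())
lemma4p6 (suc (suc m)) (suc s)       _   _               = begin
  Dnat (suc s) (suc (suc m))                   ≡⟨ Dnat-rec s m ⟩
  (Dnat s (suc m) + Dnat s m) + Dnat (suc s) m ≡⟨ cong (λ c → c + Dnat (suc s) m) (Dnat-pascal m s) ⟩
  suc m C s + Dnat (suc s) m                   ≡⟨ +-comm (suc m C s) (Dnat (suc s) m) ⟩
  Dnat (suc s) m + suc m C s                   ∎
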